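{- Let $\lambda\vdash n$ and let $S^\lambda$ be the Specht module with basis $\{e_T: T\in\mathrm{SYT}(\lambda)\}$ of standard polytabloids. For $1\le i\le n-1$ define a linear operator $\overline{\pi}_i$ on $S^\lambda$ by, for each standard tableau $T$: $\overline{\pi}_ie_T=0$ if $i$ and $i+1$ lie in the same row of $T$; $\overline{\pi}_ie_T=-e_T$ if $i$ lies directly below or strictly southeast of $i+1$ in $T$; and $\overline{\pi}_ie_T=e_{s_iT}$ if $i$ lies strictly northwest of $i+1$ in $T$. Then these operators satisfy $\overline{\pi}_i^2=-\overline{\pi}_i$, $\overline{\pi}_i\overline{\pi}_j=\overline{\pi}_j\overline{\pi}_i$ for $|i-j|\ge 2$, and $\overline{\pi}_i\overline{\pi}_{i+1}\overline{\pi}_i=\overline{\pi}_{i+1}\overline{\pi}_i\overline{\pi}_{i+1}$, so they make $S^\lambda$ into an $\mathcal{H}_n(0)$-module $\widehat{S^\lambda}$.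
   Context: Tableaux are in French notation (bottom row longest; "north/south" = higher/lower row, "west/east" = left/right; "strictly northwest" = strictly higher row and strictly further left column). A standard Young tableau $T$ of shape $\lambda$ is a filling by $1,\dots,n$ (each once) increasing along rows and up columns; in such a tableau, $i$ is always directly below, directly left of, strictly southeast of, or strictly northwest of $i+1$. $s_iT$ swaps the entries $i,i+1$. The polytabloid of a tableau $t$ is $e_t=\sum_{\sigma}\mathrm{sgn}(\sigma)\{\sigma t\}$, summed over permutations $\sigma$ preserving the set of entries of each column of $t$, where $\{\cdot\}$ denotes the tabloid (row-equivalence class); $S^\lambda$ is spanned by these, with basis the $e_T$ for $T$ standard. $\mathcal{H}_n(0)$ is the 0-Hecke algebra with generators $\overline{\pi}_1,\dots,\overline{\pi}_{n-1}$ and the three relations listed. -}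

module Defs where

open import Level using (_⊔_)
open import Data.Nat using (ℕ; zero; suc; _∸_; _<_; _≤_; _<?_; _≤?_)
import Data.Nat.Properties as ℕP
open import Data.Bool using (Bool; true; false; if_then_else_; _∧_)
open import Data.Product using (Σ; ∃; _×_; _,_; proj₁; proj₂)
import Data.Product.Properties as ×P
open import Data.Maybe using (Maybe; just; nothing)
open import Data.List using (List; []; _∷_; _++_; length; map; concatMap)
open import Data.Nat.ListAction using (sum)
import Data.List.Properties as LP
open import Data.List.Relation.Unary.All using (All)
open import Data.List.Relation.Unary.Linked using (Linked)
open import Relation.Nullary using (Dec; yes; no; does)
open import Relation.Binary.PropositionalEquality using (_≡_)
open import Algebra.Bundles using (CommutativeRing)

-- A partition of n: list of positive parts, weakly decreasing, summing to n.
-- Part number r (0-based) is the length of row r; row 0 is the BOTTOM row.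
record IsPartition (shape : List ℕ) (n : ℕ) : Set where
  field
    positive   : All (0 <_) shape
    decreasing : Linked (λ a b → b ≤ a) shape
    total      : sum shape ≡ n

rowLength : List ℕ → ℕ → ℕ
rowLength []       _       = 0
rowLength (a ∷ _)  zero    = a
rowLength (_ ∷ as) (suc r) = rowLength as r

-- A cell is (row , column), both 0-based; row 0 = bottom, column 0 = left.
Cell : Set
Cell = ℕ × ℕ

row : Cell → ℕ
row = proj₁

col : Cell → ℕ
col = proj₂

InShape : List ℕ → Cell → Set
InShape shape (r , c) = c < rowLength shape r

-- A tableau with entries 1..n is recorded as the list of positions of its
-- entries: the element at (0-based) list index k is the cell containing k+1.
Tableau : Set
Tableau = List Cell

at : {A : Set} → List A → ℕ → Maybe A
at []       _       = nothing
at (x ∷ _)  zero    = just x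
at (_ ∷ xs) (suc k) = at xs k

setAt : {A : Set} → List A → ℕ → A → List A
setAt []       _       _ = []
setAt (_ ∷ xs) zero    y = y ∷ xs
setAt (x ∷ xs) (suc k) y = x ∷ setAt xs k y

posOf : Tableau → ℕ → Maybe Cell
posOf T e = at T (e ∸ 1)

record IsSYT (shape : List ℕ) (n : ℕ) (T : Tableau) : Set where
  field
    size        : length T ≡ n
    cells       : All (InShape shape) T
    injective   : ∀ a b p → at T a ≡ just p → at T b ≡ just p → a ≡ b
    surjective  : ∀ p → InShape shape p → ∃ λ a → at T a ≡ just p
    rowIncr     : ∀ a b r c c′ → at T a ≡ just (r , c) → at T b ≡ just (r , c′) →
                  c < c′ → a < b
    colIncr     : ∀ a b r r′ c → at T a ≡ just (r , c) → at T b ≡ just (r′ , c) →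
                  r < r′ → a < b

swapEntries : ℕ → Tableau → Tableau
swapEntries i T with posOf T i | posOf T (suc i)
... | just p | just q = setAt (setAt T (i ∸ 1) q) i p
... | _      | _      = T

_≟T_ : (S T : Tableau) → Dec (S ≡ T)
_≟T_ = LP.≡-dec (×P.≡-dec ℕP._≟_ ℕP._≟_)

-- The Specht module as the free R-module on the standard tableaux
-- (basis e_T), with elements written as finite formal R-linear
-- combinations of tableaux; two combinations are equal iff every
-- tableau has the same total coefficient in both.

module FreeModule {c ℓ} (R : CommutativeRing c ℓ) where
  open CommutativeRing R

  Vect : Set c
  Vect = List (Carrier × Tableau)

  coeff : Tableau → Vect → Carrier
  coeff T []             = 0#
  coeff T ((a , S) ∷ v) = if does (S ≟T T) then a + coeff T v else coeff T v

  _≋_ : Vect → Vect → Set ℓ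
  v ≋ w = ∀ T → coeff T v ≈ coeff T w

  scale : Carrier → Vect → Vect
  scale a = map (λ { (b , S) → (a * b , S) })

  neg : Vect → Vect
  neg = scale (- 1#)

  extend : (Tableau → Vect) → Vect → Vect
  extend f = concatMap (λ { (a , S) → scale a (f S) })

  InSpecht : List ℕ → ℕ → Vect → Set c
  InSpecht shape n v = All (λ aS → IsSYT shape n (proj₂ aS)) v

  -- the operator π̄_i on a basis vector e_T, following the definition:
  --   0          if i, i+1 in the same row of T
  --   - e_T      if i is directly below or strictly southeast of i+1
  --   e_{s_i T}  if i is strictly northwest of i+1
  -- (the remaining case cannot occur for standard T; it is sent to 0)
  πbasis : ℕ → Tableau → Vect
  πbasis i T with posOf T i | posOf T (suc i)
  ... | just (r₁ , c₁) | just (r₂ , c₂) =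
    if does (r₁ ℕP.≟ r₂) then []
    else if (does (r₁ <? r₂) ∧ does (c₂ ≤? c₁)) then (- 1# , T) ∷ []
    else if (does (r₂ <? r₁) ∧ does (c₁ <? c₂)) then (1# , swapEntries i T) ∷ []
    else []
  ... | _ | _ = []

  πbar : ℕ → Vect → Vect
  πbar i = extend (πbasis i)

-- π̄_i looks only at the cells c, c′ of i and i+1 in T and sends e_T to 0, −e_T or e_{s_i T}
-- according to the relative position of c and c′, so it maps signed tableaux ±T to signed
-- tableaux or 0, and the relations can be checked on signed tableaux, for every tableau T.
-- Raising all indices by one amounts to prepending a cell to T, so it suffices to take i = 1.
-- Then π̄₁² = −π̄₁ is a computation with two cells, and π̄₁ commutes with π̄_j for j ≥ 3 since
-- the two act on disjoint parts of T. The braid relation involves the three cells of 1, 2, 3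
-- only through the relative order of their rows and of their columns; replacing every
-- coordinate by its rank among the three reduces it to the 3⁶ configurations with
-- coordinates below 3, which are checked by evaluation.
module Submission where

open import Defs
open import Level using (Level; _⊔_)
open import Function using (id; _∘_)
open import Data.Bool using (true; false; if_then_else_; _∧_)
open import Data.Empty using (⊥-elim)
open import Data.Fin using (Fin; zero; suc)
import Data.Fin.Properties as Fin
open import Data.List using (List; []; _∷_; _++_; length)
import Data.List.Properties as List
open import Data.List.Membership.Propositional using (_∈_)
open import Data.List.Relation.Unary.Any using (here; there)
import Data.List.Relation.Binary.Equality.Setoid as ListEquality
open import Data.Maybe using (Maybe; just; nothing)
import Data.Maybe as Maybe
import Data.Maybe.Properties as Maybe
open import Data.Nat using (ℕ; zero; suc; _+_; _<_; _≤_; s≤s; z≤n; ∣_-_∣; _<?_)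
import Data.Nat.Properties as ℕ
open import Data.Product using (_×_; _,_; map₁; map₂)
import Data.Product.Properties as ×
open import Data.Product.Relation.Binary.Pointwise.NonDependent using (_×ₛ_)
open import Data.Sign using (Sign)
import Data.Sign as Sign
import Data.Sign.Properties as Sign
open import Data.Sum using (_⊎_; inj₁; inj₂)
open import Algebra.Bundles using (CommutativeRing)
import Algebra.Properties.Ring as RingProperties
open import Relation.Binary.Definitions using (tri<; tri≈; tri>)
open import Relation.Binary.PropositionalEquality
  using (_≡_; refl; sym; trans; cong; cong₂; subst; module ≡-Reasoning)
import Relation.Binary.PropositionalEquality as ≡
open import Relation.Nullary using (Dec; yes; no; does)
open import Relation.Nullary.Decidable using (toWitness; dec-true; dec-false)

private
  variable
    A B : Set

-- nothing stands for 0 and just (s , x) for ±x.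
Signed : Set → Set
Signed A = Maybe (Sign × A)

mapˢ : (A → B) → Signed A → Signed B
mapˢ g = Maybe.map (map₂ g)

infixl 5 _⟫=_
_⟫=_ : Signed A → (A → Signed B) → Signed B
nothing       ⟫= k = nothing
just (s , x)  ⟫= k = Maybe.map (map₁ (s Sign.*_)) (k x)

infixr 9 _⊙_
_⊙_ : (A → Signed A) → (A → Signed A) → A → Signed A
(l ⊙ k) x = k x ⟫= l

negateˢ : A → Signed A
negateˢ x = just (Sign.- , x)

Braid : (A → Signed A) → (A → Signed A) → A → Set
Braid k l x = (k ⊙ l ⊙ k) x ≡ (l ⊙ k ⊙ l) x

record Intertwines (g : A → B) (k : A → Signed A) (k′ : B → Signed B) : Set where
  constructor intertwining
  field natural : ∀ x → k′ (g x) ≡ mapˢ g (k x)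

open Intertwines

⟫=-intertwines : {g : A → B} {k : A → Signed A} {k′ : B → Signed B} →
                 Intertwines g k k′ → ∀ m → mapˢ g m ⟫= k′ ≡ mapˢ g (m ⟫= k)
⟫=-intertwines g∘k nothing = refl
⟫=-intertwines {k = k} g∘k (just (s , x)) rewrite natural g∘k x with k x
... | nothing       = refl
... | just (t , y)  = refl

⊙-intertwines : {g : A → B} {k l : A → Signed A} {k′ l′ : B → Signed B} →
                Intertwines g k k′ → Intertwines g l l′ → Intertwines g (l ⊙ k) (l′ ⊙ k′)
⊙-intertwines {k = k} g∘k g∘l = intertwining λ x →
  trans (cong (_⟫= _) (natural g∘k x)) (⟫=-intertwines g∘l (k x))

negateˢ-intertwines : (g : A → B) → Intertwines g negateˢ negateˢ
negateˢ-intertwines g = intertwining λ x → refl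

transfer : {g : A → B} {w v : A → Signed A} {w′ v′ : B → Signed B} →
           Intertwines g w w′ → Intertwines g v v′ → ∀ x → w x ≡ v x → w′ (g x) ≡ v′ (g x)
transfer {g = g} g∘w g∘v x w≡v =
  trans (natural g∘w x) (trans (cong (mapˢ g) w≡v) (sym (natural g∘v x)))

Braid-intertwines : {g : A → B} {k l : A → Signed A} {k′ l′ : B → Signed B} →
                    Intertwines g k k′ → Intertwines g l l′ → ∀ x → Braid k l x → Braid k′ l′ (g x)
Braid-intertwines g∘k g∘l =
  transfer (⊙-intertwines (⊙-intertwines g∘k g∘l) g∘k) (⊙-intertwines (⊙-intertwines g∘l g∘k) g∘l)

onFst : (A → Signed A) → A × B → Signed (A × B)
onFst k (x , y) = mapˢ (_, y) (k x)

onSnd : (B → Signed B) → A × B → Signed (A × B)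
onSnd l (x , y) = mapˢ (x ,_) (l y)

onFst-onSnd-commute : (k : A → Signed A) (l : B → Signed B) →
                      ∀ z → (onFst k ⊙ onSnd l) z ≡ (onSnd l ⊙ onFst k) z
onFst-onSnd-commute k l (x , y) with k x in kx | l y in ly
... | nothing       | nothing       = refl
... | nothing       | just _        rewrite kx = refl
... | just _        | nothing       rewrite ly = refl
... | just (s , x′) | just (t , y′) rewrite kx | ly =
  cong (λ r → just (r , x′ , y′)) (Sign.*-comm t s)

data Effect : Set where
  vanish negate exchange : Effect

perform : Effect → A → A → Signed A
perform vanish   x x′ = nothing
perform negate   x x′ = just (Sign.- , x)
perform exchange x x′ = just (Sign.+ , x′)

perform-natural : ∀ (g : A → B) e x x′ → mapˢ g (perform e x x′) ≡ perform e (g x) (g x′)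
perform-natural g vanish   x x′ = refl
perform-natural g negate   x x′ = refl
perform-natural g exchange x x′ = refl

data Comparison : Set where
  less equal greater : Comparison

compareℕ : ℕ → ℕ → Comparison
compareℕ m n with ℕ.<-cmp m n
... | tri< _ _ _ = less
... | tri≈ _ _ _ = equal
... | tri> _ _ _ = greater

flipᶜ : Comparison → Comparison
flipᶜ less    = greater
flipᶜ equal   = equal
flipᶜ greater = less

compareℕ-< : ∀ {m n} → m < n → compareℕ m n ≡ less
compareℕ-< {m} {n} m<n with ℕ.<-cmp m n
... | tri< _ _ _    = refl
... | tri≈ m≮n _ _  = ⊥-elim (m≮n m<n)
... | tri> m≮n _ _  = ⊥-elim (m≮n m<n)

compareℕ-≡ : ∀ {m n} → m ≡ n → compareℕ m n ≡ equal
compareℕ-≡ {m} {n} m≡n with ℕ.<-cmp m n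
... | tri< _ m≢n _  = ⊥-elim (m≢n m≡n)
... | tri≈ _ _ _    = refl
... | tri> _ m≢n _  = ⊥-elim (m≢n m≡n)

compareℕ-> : ∀ {m n} → n < m → compareℕ m n ≡ greater
compareℕ-> {m} {n} n<m with ℕ.<-cmp m n
... | tri< _ _ n≮m  = ⊥-elim (n≮m n<m)
... | tri≈ _ _ n≮m  = ⊥-elim (n≮m n<m)
... | tri> _ _ _    = refl

compareℕ-flip : ∀ m n → compareℕ n m ≡ flipᶜ (compareℕ m n)
compareℕ-flip m n with ℕ.<-cmp m n
... | tri< m<n _ _ = compareℕ-> m<n
... | tri≈ _ m≡n _ = compareℕ-≡ (sym m≡n)
... | tri> _ _ n<m = compareℕ-< n<m

-- The arguments compare the rows, then the columns, of the cells holding i and i+1. The case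
-- `less less` (i+1 strictly northeast of i) cannot occur in a standard tableau; πbasis sends it to 0.
effectᶜ : Comparison → Comparison → Effect
effectᶜ less    less = vanish
effectᶜ less    _    = negate
effectᶜ equal   _    = vanish
effectᶜ greater less = exchange
effectᶜ greater _    = vanish

effect : Cell → Cell → Effect
effect (r₁ , c₁) (r₂ , c₂) = effectᶜ (compareℕ r₁ r₂) (compareℕ c₁ c₂)

effectᶜ-flip : ∀ x y → effectᶜ x y ≡ exchange → effectᶜ (flipᶜ x) (flipᶜ y) ≡ negate
effectᶜ-flip greater less    _  = refl
effectᶜ-flip less    less    ()
effectᶜ-flip less    equal   ()
effectᶜ-flip less    greater ()
effectᶜ-flip equal   _       ()
effectᶜ-flip greater equal   ()
effectᶜ-flip greater greater ()

effect-flip : ∀ p q → effect p q ≡ exchange → effect q p ≡ negate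
effect-flip (r₁ , c₁) (r₂ , c₂) e
  rewrite compareℕ-flip r₁ r₂ | compareℕ-flip c₁ c₂ = effectᶜ-flip _ _ e

rank : List ℕ → ℕ → ℕ
rank []       v = 0
rank (x ∷ xs) v with x <? v
... | yes _ = suc (rank xs v)
... | no  _ = rank xs v

rank-≤-length : ∀ xs v → rank xs v ≤ length xs
rank-≤-length []       v = z≤n
rank-≤-length (x ∷ xs) v with x <? v
... | yes _ = s≤s (rank-≤-length xs v)
... | no  _ = ℕ.m≤n⇒m≤1+n (rank-≤-length xs v)

rank-mono : ∀ xs {v w} → v ≤ w → rank xs v ≤ rank xs w
rank-mono []       v≤w = z≤n
rank-mono (x ∷ xs) {v} {w} v≤w with x <? v | x <? w
... | yes _   | yes _   = s≤s (rank-mono xs v≤w)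
... | yes x<v | no  x≮w = ⊥-elim (x≮w (ℕ.<-≤-trans x<v v≤w))
... | no  _   | yes _   = ℕ.m≤n⇒m≤1+n (rank-mono xs v≤w)
... | no  _   | no  _   = rank-mono xs v≤w

rank-strict : ∀ xs {v w} → v ∈ xs → v < w → rank xs v < rank xs w
rank-strict (v ∷ xs) {v} {w} (here refl) v<w with v <? v | v <? w
... | yes v<v | _       = ⊥-elim (ℕ.<-irrefl refl v<v)
... | no  _   | yes _   = s≤s (rank-mono xs (ℕ.<⇒≤ v<w))
... | no  _   | no  v≮w = ⊥-elim (v≮w v<w)
rank-strict (x ∷ xs) {v} {w} (there v∈xs) v<w with x <? v | x <? w
... | yes _   | yes _   = s≤s (rank-strict xs v∈xs v<w)
... | yes x<v | no  x≮w = ⊥-elim (x≮w (ℕ.<-trans x<v v<w))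
... | no  _   | yes _   = ℕ.m<n⇒m<1+n (rank-strict xs v∈xs v<w)
... | no  _   | no  _   = rank-strict xs v∈xs v<w

rank<length : ∀ xs {v} → v ∈ xs → rank xs v < length xs
rank<length (v ∷ xs) {v} (here refl) with v <? v
... | yes v<v = ⊥-elim (ℕ.<-irrefl refl v<v)
... | no  _   = s≤s (rank-≤-length xs v)
rank<length (x ∷ xs) {v} (there v∈xs) with x <? v
... | yes _ = s≤s (rank<length xs v∈xs)
... | no  _ = ℕ.m<n⇒m<1+n (rank<length xs v∈xs)

compareℕ-rank : ∀ xs {v w} → v ∈ xs → w ∈ xs → compareℕ (rank xs v) (rank xs w) ≡ compareℕ v w
compareℕ-rank xs {v} {w} v∈xs w∈xs with ℕ.<-cmp v w
... | tri< v<w _ _  = compareℕ-< (rank-strict xs v∈xs v<w)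
... | tri≈ _ refl _ = compareℕ-≡ refl
... | tri> _ _ w<v  = compareℕ-> (rank-strict xs w∈xs w<v)

Triple : Set → Set
Triple A = A × A × A

map₃ : (A → B) → Triple A → Triple B
map₃ f (x , y , z) = f x , f y , f z

σ₁ σ₂ : (A → A → Effect) → Triple A → Signed (Triple A)
σ₁ E (x , y , z) = perform (E x y) (x , y , z) (y , x , z)
σ₂ E (x , y , z) = perform (E y z) (x , y , z) (x , z , y)

module _ {E : A → A → Effect} {E′ : B → B → Effect} (f : A → B)
         (f-preserves : ∀ a b → E′ (f a) (f b) ≡ E a b) where

  σ₁-natural : Intertwines (map₃ f) (σ₁ E) (σ₁ E′)
  σ₁-natural = intertwining λ where
    (x , y , z) → trans (cong (λ e → perform e _ _) (f-preserves x y))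
                        (sym (perform-natural (map₃ f) (E x y) _ _))

  σ₂-natural : Intertwines (map₃ f) (σ₂ E) (σ₂ E′)
  σ₂-natural = intertwining λ where
    (x , y , z) → trans (cong (λ e → perform e _ _) (f-preserves y z))
                        (sym (perform-natural (map₃ f) (E y z) _ _))

  braid-map : ∀ u → Braid (σ₁ E) (σ₂ E) u → Braid (σ₁ E′) (σ₂ E′) (map₃ f u)
  braid-map = Braid-intertwines σ₁-natural σ₂-natural

pick : Triple A → Fin 3 → A
pick (x , y , z) zero             = x
pick (x , y , z) (suc zero)       = y
pick (x , y , z) (suc (suc zero)) = z

pick-map₃ : ∀ (f : A → B) t a → pick (map₃ f t) a ≡ f (pick t a)
pick-map₃ f t zero             = refl
pick-map₃ f t (suc zero)       = refl
pick-map₃ f t (suc (suc zero)) = refl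

positions : Triple (Fin 3)
positions = zero , suc zero , suc (suc zero)

-- The cells enter the braid computation only through `oracle t`, so it can be run on the
-- positions 0, 1, 2 instead of the cells themselves.
oracle : Triple Cell → Fin 3 → Fin 3 → Effect
oracle t a b = effect (pick t a) (pick t b)

OracleBraid : Triple Cell → Set
OracleBraid t = Braid (σ₁ (oracle t)) (σ₂ (oracle t)) positions

oracleBraid? : ∀ t → Dec (OracleBraid t)
oracleBraid? t = Maybe.≡-dec (×.≡-dec Sign._≟_ (×.≡-dec Fin._≟_ (×.≡-dec Fin._≟_ Fin._≟_))) _ _

small-oracleBraid : ∀ {a b c d e f} → a < 3 → b < 3 → c < 3 → d < 3 → e < 3 → f < 3 →
                    OracleBraid ((a , d) , (b , e) , (c , f))
small-oracleBraid a<3 b<3 c<3 d<3 e<3 f<3 = checked a<3 b<3 c<3 d<3 e<3 f<3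
  where
  all<3? = λ {P} P? → ℕ.allUpTo? {P = P} P? 3
  checked = toWitness {a? = all<3? λ a → all<3? λ b → all<3? λ c →
                            all<3? λ d → all<3? λ e → all<3? λ f →
                            oracleBraid? ((a , d) , (b , e) , (c , f))} _

coordinates : (Cell → ℕ) → Triple Cell → List ℕ
coordinates f t = f (pick t zero) ∷ f (pick t (suc zero)) ∷ f (pick t (suc (suc zero))) ∷ []

coordinate-∈ : ∀ f t a → f (pick t a) ∈ coordinates f t
coordinate-∈ f t zero             = here refl
coordinate-∈ f t (suc zero)       = there (here refl)
coordinate-∈ f t (suc (suc zero)) = there (there (here refl))

rankWithin : Triple Cell → Cell → Cell
rankWithin t p = rank (coordinates row t) (row p) , rank (coordinates col t) (col p)

compress : Triple Cell → Triple Cell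
compress t = map₃ (rankWithin t) t

oracle-compress : ∀ t a b → oracle (compress t) a b ≡ oracle t a b
oracle-compress t a b = begin
  effect (pick (compress t) a) (pick (compress t) b)
    ≡⟨ cong₂ effect (pick-map₃ (rankWithin t) t a) (pick-map₃ (rankWithin t) t b) ⟩
  effectᶜ (compareℕ (rank rs (row (pick t a))) (rank rs (row (pick t b))))
          (compareℕ (rank cs (col (pick t a))) (rank cs (col (pick t b))))
    ≡⟨ cong₂ effectᶜ (compareℕ-rank rs (coordinate-∈ row t a) (coordinate-∈ row t b))
                     (compareℕ-rank cs (coordinate-∈ col t a) (coordinate-∈ col t b)) ⟩
  oracle t a b
    ∎
  where open ≡-Reasoning
        rs = coordinates row t
        cs = coordinates col t

window-braid : ∀ t → Braid (σ₁ effect) (σ₂ effect) t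
window-braid t =
  braid-map {E = oracle t} {E′ = effect} (pick t) (λ _ _ → refl) positions
    (braid-map {E = oracle (compress t)} {E′ = oracle t} id (λ a b → sym (oracle-compress t a b))
               positions
      (small-oracleBraid (bound row zero) (bound row (suc zero)) (bound row (suc (suc zero)))
                         (bound col zero) (bound col (suc zero)) (bound col (suc (suc zero)))))
  where bound : ∀ f a → rank (coordinates f t) (f (pick t a)) < 3
        bound f a = rank<length (coordinates f t) (coordinate-∈ f t a)

-- π̂ k T is π̄_{k+1} e_T: list index k of a tableau holds the entry k+1.
π̂ : ℕ → Tableau → Signed Tableau
π̂ k T with at T k | at T (suc k)
... | just p | just q = perform (effect p q) T (swapEntries (suc k) T)
... | _      | _      = nothing

swapEntries-cons : ∀ k x T → swapEntries (suc (suc k)) (x ∷ T) ≡ x ∷ swapEntries (suc k) T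
swapEntries-cons k x T with at T k | at T (suc k)
... | just p  | just q  = refl
... | just p  | nothing = refl
... | nothing | _       = refl

π̂-cons : ∀ k x → Intertwines (x ∷_) (π̂ k) (π̂ (suc k))
π̂-cons k x = intertwining natural-cons
  where
  natural-cons : ∀ T → π̂ (suc k) (x ∷ T) ≡ mapˢ (x ∷_) (π̂ k T)
  natural-cons T with at T k | at T (suc k)
  ... | just p  | just q  = trans (cong (perform (effect p q) (x ∷ T)) (swapEntries-cons k x T))
                                  (sym (perform-natural (x ∷_) (effect p q) T _))
  ... | just _  | nothing = refl
  ... | nothing | _       = refl

π̂-quadratic : ∀ k T → (π̂ k ⊙ π̂ k) T ≡ (negateˢ ⊙ π̂ k) T
π̂-quadratic zero []          = refl
π̂-quadratic zero (p ∷ [])    = refl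
π̂-quadratic zero (p ∷ q ∷ U) with effect p q in pq
... | vanish   = refl
... | negate   rewrite pq = refl
... | exchange rewrite effect-flip p q pq = refl
π̂-quadratic (suc k) []       = refl
π̂-quadratic (suc k) (x ∷ T)  =
  transfer (⊙-intertwines (π̂-cons k x) (π̂-cons k x))
           (⊙-intertwines (π̂-cons k x) (negateˢ-intertwines (x ∷_))) T (π̂-quadratic k T)

π̂-braid : ∀ k T → Braid (π̂ k) (π̂ (suc k)) T
π̂-braid zero []              = refl
π̂-braid zero (p ∷ [])        = refl
π̂-braid zero (p ∷ q ∷ [])    with effect p q
... | vanish   = refl
... | negate   = refl
... | exchange = refl
π̂-braid zero (p ∷ q ∷ r ∷ U) =
  Braid-intertwines σ₁-place σ₂-place (p , q , r) (window-braid (p , q , r))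
  where
  place : Triple Cell → Tableau
  place (x , y , z) = x ∷ y ∷ z ∷ U
  σ₁-place : Intertwines place (σ₁ effect) (π̂ zero)
  σ₁-place = intertwining λ where (x , y , z) → sym (perform-natural place (effect x y) _ _)
  σ₂-place : Intertwines place (σ₂ effect) (π̂ (suc zero))
  σ₂-place = intertwining λ where (x , y , z) → sym (perform-natural place (effect y z) _ _)
π̂-braid (suc k) []           = refl
π̂-braid (suc k) (x ∷ T)      = Braid-intertwines (π̂-cons k x) (π̂-cons (suc k) x) T (π̂-braid k T)

π̂-commute : ∀ k l → 2 + k ≤ l → ∀ T → (π̂ k ⊙ π̂ l) T ≡ (π̂ l ⊙ π̂ k) T
π̂-commute zero (suc (suc l)) (s≤s (s≤s z≤n)) []          = refl
π̂-commute zero (suc (suc l)) (s≤s (s≤s z≤n)) (p ∷ [])    = refl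
π̂-commute zero (suc (suc l)) (s≤s (s≤s z≤n)) (p ∷ q ∷ U) =
  transfer (⊙-intertwines split-snd split-fst) (⊙-intertwines split-fst split-snd) ((p , q) , U)
           (onFst-onSnd-commute adjacent (π̂ l) ((p , q) , U))
  where
  open ≡-Reasoning
  split : (Cell × Cell) × Tableau → Tableau
  split ((x , y) , V) = x ∷ y ∷ V
  adjacent : Cell × Cell → Signed (Cell × Cell)
  adjacent (x , y) = perform (effect x y) (x , y) (y , x)
  split-fst : Intertwines split (onFst adjacent) (π̂ zero)
  split-fst = intertwining λ where
    ((x , y) , V) → sym (trans (sym (Maybe.map-∘ (perform (effect x y) (x , y) (y , x))))
                               (perform-natural (λ z → split (z , V)) (effect x y) _ _))
  split-snd : Intertwines split (onSnd (π̂ l)) (π̂ (suc (suc l)))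
  split-snd = intertwining λ where
    ((x , y) , V) → begin
      π̂ (suc (suc l)) (x ∷ y ∷ V)       ≡⟨ natural (π̂-cons (suc l) x) (y ∷ V) ⟩
      mapˢ (x ∷_) (π̂ (suc l) (y ∷ V))   ≡⟨ cong (mapˢ (x ∷_)) (natural (π̂-cons l y) V) ⟩
      mapˢ (x ∷_) (mapˢ (y ∷_) (π̂ l V)) ≡⟨ Maybe.map-∘ (π̂ l V) ⟨
      mapˢ (λ W → x ∷ y ∷ W) (π̂ l V)    ≡⟨ Maybe.map-∘ (π̂ l V) ⟩
      mapˢ split (mapˢ ((x , y) ,_) (π̂ l V)) ∎
π̂-commute (suc k) (suc l) (s≤s 2+k≤l) []      = refl
π̂-commute (suc k) (suc l) (s≤s 2+k≤l) (x ∷ T) =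
  transfer (⊙-intertwines (π̂-cons l x) (π̂-cons k x)) (⊙-intertwines (π̂-cons k x) (π̂-cons l x)) T
           (π̂-commute k l 2+k≤l T)

≤∣m-n∣⇒d+m≤n⊎d+n≤m : ∀ {d} m n → d ≤ ∣ m - n ∣ → d + m ≤ n ⊎ d + n ≤ m
≤∣m-n∣⇒d+m≤n⊎d+n≤m {d} m n d≤∣m-n∣ with ℕ.≤-total m n
... | inj₁ m≤n = inj₁ (ℕ.m≤o∸n⇒m+n≤o d m≤n (subst (d ≤_) (ℕ.m≤n⇒∣m-n∣≡n∸m m≤n) d≤∣m-n∣))
... | inj₂ n≤m = inj₂ (ℕ.m≤o∸n⇒m+n≤o d n≤m (subst (d ≤_) (ℕ.m≤n⇒∣n-m∣≡n∸m n≤m) d≤∣m-n∣))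

π̂-commute-far : ∀ k l → 2 ≤ ∣ k - l ∣ → ∀ T → (π̂ k ⊙ π̂ l) T ≡ (π̂ l ⊙ π̂ k) T
π̂-commute-far k l 2≤∣k-l∣ T with ≤∣m-n∣⇒d+m≤n⊎d+n≤m k l 2≤∣k-l∣
... | inj₁ 2+k≤l = π̂-commute k l 2+k≤l T
... | inj₂ 2+l≤k = sym (π̂-commute l k 2+l≤k T)

module _ {c ℓ} (R : CommutativeRing c ℓ) where
  open CommutativeRing R
    renaming (_+_ to _+ᴿ_; refl to ≈-refl; sym to ≈-sym; trans to ≈-trans; reflexive to ≈-reflexive)
  open RingProperties ring using (-1*x≈-x; -‿involutive)
  open FreeModule R
  -- Termwise equality of formal sums: finer than ≋, and respected by πbar and neg.
  open ListEquality (setoid ×ₛ ≡.setoid Tableau)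
    using ([]; _∷_; ≋-reflexive; ≋-sym; ≋-trans; ++⁺) renaming (_≋_ to _≃_)

  ⟪_⟫ : Sign → Carrier
  ⟪ Sign.+ ⟫ = 1#
  ⟪ Sign.- ⟫ = - 1#

  ⟦_⟧ : Signed Tableau → Vect
  ⟦ nothing ⟧      = []
  ⟦ just (s , T) ⟧ = (⟪ s ⟫ , T) ∷ []

  if-effect : ∀ r₁ c₁ r₂ c₂ (x x′ : Tableau) →
    (if does (r₁ ℕ.≟ r₂) then []
     else if does (r₁ <? r₂) ∧ does (c₂ ℕ.≤? c₁) then (- 1# , x) ∷ []
     else if does (r₂ <? r₁) ∧ does (c₁ <? c₂) then (1# , x′) ∷ []
     else []) ≡ ⟦ perform (effect (r₁ , c₁) (r₂ , c₂)) x x′ ⟧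
  if-effect r₁ c₁ r₂ c₂ x x′ with ℕ.<-cmp r₁ r₂ | ℕ.<-cmp c₁ c₂
  ... | tri≈ _ r₁≡r₂ _ | _ rewrite dec-true (r₁ ℕ.≟ r₂) r₁≡r₂ = refl
  ... | tri< r₁<r₂ r₁≢r₂ r₂≮r₁ | tri< c₁<c₂ _ _
    rewrite dec-false (r₁ ℕ.≟ r₂) r₁≢r₂ | dec-true (r₁ <? r₂) r₁<r₂
          | dec-false (c₂ ℕ.≤? c₁) (ℕ.<⇒≱ c₁<c₂) | dec-false (r₂ <? r₁) r₂≮r₁ = refl
  ... | tri< r₁<r₂ r₁≢r₂ _ | tri≈ _ c₁≡c₂ _
    rewrite dec-false (r₁ ℕ.≟ r₂) r₁≢r₂ | dec-true (r₁ <? r₂) r₁<r₂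
          | dec-true (c₂ ℕ.≤? c₁) (ℕ.≤-reflexive (sym c₁≡c₂)) = refl
  ... | tri< r₁<r₂ r₁≢r₂ _ | tri> _ _ c₂<c₁
    rewrite dec-false (r₁ ℕ.≟ r₂) r₁≢r₂ | dec-true (r₁ <? r₂) r₁<r₂
          | dec-true (c₂ ℕ.≤? c₁) (ℕ.<⇒≤ c₂<c₁) = refl
  ... | tri> r₁≮r₂ r₁≢r₂ r₂<r₁ | tri< c₁<c₂ _ _
    rewrite dec-false (r₁ ℕ.≟ r₂) r₁≢r₂ | dec-false (r₁ <? r₂) r₁≮r₂
          | dec-true (r₂ <? r₁) r₂<r₁ | dec-true (c₁ <? c₂) c₁<c₂ = refl
  ... | tri> r₁≮r₂ r₁≢r₂ r₂<r₁ | tri≈ c₁≮c₂ _ _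
    rewrite dec-false (r₁ ℕ.≟ r₂) r₁≢r₂ | dec-false (r₁ <? r₂) r₁≮r₂
          | dec-true (r₂ <? r₁) r₂<r₁ | dec-false (c₁ <? c₂) c₁≮c₂ = refl
  ... | tri> r₁≮r₂ r₁≢r₂ r₂<r₁ | tri> c₁≮c₂ _ _
    rewrite dec-false (r₁ ℕ.≟ r₂) r₁≢r₂ | dec-false (r₁ <? r₂) r₁≮r₂
          | dec-true (r₂ <? r₁) r₂<r₁ | dec-false (c₁ <? c₂) c₁≮c₂ = refl

  πbasis-π̂ : ∀ k T → πbasis (suc k) T ≡ ⟦ π̂ k T ⟧
  πbasis-π̂ k T with at T k | at T (suc k)
  ... | just (r₁ , c₁) | just (r₂ , c₂) = if-effect r₁ c₁ r₂ c₂ T (swapEntries (suc k) T)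
  ... | just _  | nothing = refl
  ... | nothing | _       = refl

  ⟪⟫-* : ∀ s t → ⟪ s Sign.* t ⟫ ≈ ⟪ s ⟫ * ⟪ t ⟫
  ⟪⟫-* Sign.+ t      = ≈-sym (*-identityˡ ⟪ t ⟫)
  ⟪⟫-* Sign.- Sign.+ = ≈-sym (*-identityʳ (- 1#))
  ⟪⟫-* Sign.- Sign.- = ≈-sym (≈-trans (-1*x≈-x (- 1#)) (-‿involutive 1#))

  scale-⟫= : ∀ a s m → scale (a * ⟪ s ⟫) ⟦ m ⟧ ≃ scale a ⟦ Maybe.map (map₁ (s Sign.*_)) m ⟧
  scale-⟫= a s nothing        = []
  scale-⟫= a s (just (t , U)) = (≈-trans (*-assoc a ⟪ s ⟫ ⟪ t ⟫) (*-congˡ (≈-sym (⟪⟫-* s t))) , refl) ∷ []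

  scale-congˡ : ∀ {a b} v → a ≈ b → scale a v ≃ scale b v
  scale-congˡ []            a≈b = []
  scale-congˡ ((x , S) ∷ v) a≈b = (*-congʳ a≈b , refl) ∷ scale-congˡ v a≈b

  scale-congʳ : ∀ a {u w} → u ≃ w → scale a u ≃ scale a w
  scale-congʳ a []                   = []
  scale-congʳ a ((x≈y , refl) ∷ u≃w) = (*-congˡ x≈y , refl) ∷ scale-congʳ a u≃w

  extend-cong : ∀ f {u w} → u ≃ w → extend f u ≃ extend f w
  extend-cong f []                                  = []
  extend-cong f {(_ , S) ∷ _} ((a≈b , refl) ∷ u≃w) = ++⁺ (scale-congˡ (f S) a≈b) (extend-cong f u≃w)

  ≃⇒≋ : ∀ {u w} → u ≃ w → u ≋ w
  ≃⇒≋ [] T = ≈-refl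
  ≃⇒≋ {(_ , S) ∷ _} ((a≈b , refl) ∷ u≃w) T with does (S ≟T T)
  ... | true  = +-cong a≈b (≃⇒≋ u≃w T)
  ... | false = ≃⇒≋ u≃w T

  coeff-++ : ∀ T u w → coeff T (u ++ w) ≈ coeff T u +ᴿ coeff T w
  coeff-++ T []            w = ≈-sym (+-identityˡ (coeff T w))
  coeff-++ T ((a , S) ∷ u) w with does (S ≟T T)
  ... | true  = ≈-trans (+-congˡ (coeff-++ T u w)) (≈-sym (+-assoc a _ _))
  ... | false = coeff-++ T u w

  record Realizes (F : Vect → Vect) (φ : Tableau → Signed Tableau) : Set (c ⊔ ℓ) where
    field
      preserves-[] : F [] ≡ []
      preserves-++ : ∀ u w → F (u ++ w) ≡ F u ++ F w
      respects-≃   : ∀ {u w} → u ≃ w → F u ≃ F w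
      on-basis     : ∀ a T → F ((a , T) ∷ []) ≃ scale a ⟦ φ T ⟧

    on-monomial : ∀ a m → F (scale a ⟦ m ⟧) ≃ scale a ⟦ m ⟫= φ ⟧
    on-monomial a nothing        = ≋-reflexive preserves-[]
    on-monomial a (just (s , U)) = ≋-trans (on-basis (a * ⟪ s ⟫) U) (scale-⟫= a s (φ U))

  open Realizes

  Realizes-⊙ : ∀ {F G φ ψ} → Realizes F φ → Realizes G ψ → Realizes (F ∘ G) (φ ⊙ ψ)
  Realizes-⊙ {F} {G} {φ} {ψ} F∼φ G∼ψ = record
    { preserves-[] = trans (cong F (preserves-[] G∼ψ)) (preserves-[] F∼φ)
    ; preserves-++ = λ u w → trans (cong F (preserves-++ G∼ψ u w)) (preserves-++ F∼φ (G u) (G w))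
    ; respects-≃   = respects-≃ F∼φ ∘ respects-≃ G∼ψ
    ; on-basis     = λ a T → ≋-trans (respects-≃ F∼φ (on-basis G∼ψ a T)) (on-monomial F∼φ a (ψ T))
    }

  Realizes-≋ : ∀ {F G φ ψ} → Realizes F φ → Realizes G ψ → (∀ T → φ T ≡ ψ T) → ∀ v → F v ≋ G v
  Realizes-≋ F∼φ G∼ψ φ≗ψ [] T
    rewrite preserves-[] F∼φ | preserves-[] G∼ψ = ≈-refl
  Realizes-≋ {F} {G} F∼φ G∼ψ φ≗ψ ((a , S) ∷ v) T
    rewrite preserves-++ F∼φ ((a , S) ∷ []) v | preserves-++ G∼ψ ((a , S) ∷ []) v =
    ≈-trans (coeff-++ T (F ((a , S) ∷ [])) (F v))
      (≈-trans (+-cong (≃⇒≋ basis T) (Realizes-≋ F∼φ G∼ψ φ≗ψ v T))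
               (≈-sym (coeff-++ T (G ((a , S) ∷ [])) (G v))))
    where
    basis : F ((a , S) ∷ []) ≃ G ((a , S) ∷ [])
    basis = ≋-trans (on-basis F∼φ a S)
              (≋-trans (≋-reflexive (cong (λ m → scale a ⟦ m ⟧) (φ≗ψ S))) (≋-sym (on-basis G∼ψ a S)))

  πbar-realizes : ∀ k → Realizes (πbar (suc k)) (π̂ k)
  πbar-realizes k = record
    { preserves-[] = refl
    ; preserves-++ = List.concatMap-++ _
    ; respects-≃   = extend-cong (πbasis (suc k))
    ; on-basis     = λ a T → ≋-reflexive (trans (List.++-identityʳ _) (cong (scale a) (πbasis-π̂ k T)))
    }

  neg-realizes : Realizes neg negateˢ
  neg-realizes = record
    { preserves-[] = refl
    ; preserves-++ = List.map-++ _
    ; respects-≃   = scale-congʳ (- 1#)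
    ; on-basis     = λ a T → (*-comm (- 1#) a , refl) ∷ []
    }

  πbar-quadratic : ∀ k v → πbar (suc k) (πbar (suc k) v) ≋ neg (πbar (suc k) v)
  πbar-quadratic k =
    Realizes-≋ (Realizes-⊙ (πbar-realizes k) (πbar-realizes k))
               (Realizes-⊙ neg-realizes (πbar-realizes k)) (π̂-quadratic k)

  πbar-commute : ∀ k l → 2 ≤ ∣ k - l ∣ → ∀ v →
                 πbar (suc k) (πbar (suc l) v) ≋ πbar (suc l) (πbar (suc k) v)
  πbar-commute k l 2≤∣k-l∣ =
    Realizes-≋ (Realizes-⊙ (πbar-realizes k) (πbar-realizes l))
               (Realizes-⊙ (πbar-realizes l) (πbar-realizes k)) (π̂-commute-far k l 2≤∣k-l∣)

  πbar-braid : ∀ k v →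
               πbar (suc k) (πbar (2 + k) (πbar (suc k) v)) ≋ πbar (2 + k) (πbar (suc k) (πbar (2 + k) v))
  πbar-braid k =
    Realizes-≋ (Realizes-⊙ (πbar-realizes k) (Realizes-⊙ (πbar-realizes (suc k)) (πbar-realizes k)))
               (Realizes-⊙ (πbar-realizes (suc k)) (Realizes-⊙ (πbar-realizes k) (πbar-realizes (suc k))))
               (π̂-braid k)

-- The relations hold on every basis vector e_T, standard or not.
proposition4 : ∀ {c ℓ : Level} (R : CommutativeRing c ℓ) (n : ℕ) (shape : List ℕ) →
    IsPartition shape n →
    let open FreeModule R in
    (∀ i → 1 ≤ i → i < n → ∀ v → InSpecht shape n v →
      πbar i (πbar i v) ≋ neg (πbar i v))
    × (∀ i j → 1 ≤ i → i < n → 1 ≤ j → j < n → 2 ≤ ∣ i - j ∣ → ∀ v → InSpecht shape n v →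
      πbar i (πbar j v) ≋ πbar j (πbar i v))
    × (∀ i → 1 ≤ i → i + 1 < n → ∀ v → InSpecht shape n v →
      πbar i (πbar (i + 1) (πbar i v)) ≋ πbar (i + 1) (πbar i (πbar (i + 1) v)))
proposition4 R n shape _ = quadratic , commute , braid
  where
  open FreeModule R
  quadratic : ∀ i → 1 ≤ i → i < n → ∀ v → InSpecht shape n v → πbar i (πbar i v) ≋ neg (πbar i v)
  quadratic (suc k) _ _ v _ = πbar-quadratic R k v
  commute : ∀ i j → 1 ≤ i → i < n → 1 ≤ j → j < n → 2 ≤ ∣ i - j ∣ → ∀ v → InSpecht shape n v →
            πbar i (πbar j v) ≋ πbar j (πbar i v)
  commute (suc k) (suc l) _ _ _ _ 2≤∣k-l∣ v _ = πbar-commute R k l 2≤∣k-l∣ v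
  braid : ∀ i → 1 ≤ i → i + 1 < n → ∀ v → InSpecht shape n v →
          πbar i (πbar (i + 1) (πbar i v)) ≋ πbar (i + 1) (πbar i (πbar (i + 1) v))
  braid (suc k) _ _ v _ rewrite ℕ.+-comm k 1 = πbar-braid R k v
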